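{- For $n\ge 4$, the wheel $W_n$ satisfies $\nu^*(W_n)=\frac{13n^2+n}{2}$.
   Context: The wheel $W_n=C_n*K_1$ is the $(n+1)$-vertex graph obtained from the $n$-cycle $C_n$ by adding one new vertex (the hub) adjacent to all $n$ cycle vertices. For a finite simple graph $G=(V,E)$ with $p=|V|$, $q=|E|$, $\ell=p+q$, a construction sequence (c-sequence) for $G$ is a bijection $x:\{1,\dots,\ell\}\to V\sqcup E$ such that for every edge $e=uw$, $x^{ -1}(e)>\max\{x^{ -1}(u),x^{ -1}(w)\}$. The cost of an edge $e=uw$ in $x$ is $\nu(e,x)=(x^{ -1}(e)-x^{ -1}(u))+(x^{ -1}(e)-x^{ -1}(w))$, and the cost of $x$ is $\nu(x)=\sum_{e\in E}\nu(e,x)$. The max cost of $G$ is $\nu^*(G)=\max\nu(x)$ over all c-sequences $x$ for $G$. -}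

module Defs where

open import Data.Nat using (ℕ; zero; suc; _+_; _*_; _∸_; _<_; _≤_)
open import Data.Nat.DivMod using (_mod_)
open import Data.Fin using (Fin; toℕ; splitAt)
import Data.Fin as F
open import Data.Sum using (_⊎_; inj₁; inj₂)
open import Data.Product using (_×_; _,_; proj₁; proj₂; Σ; ∃)
open import Data.List using (map)
open import Data.Nat.ListAction using (sum)
open import Relation.Binary.PropositionalEquality using (_≡_)
open import Data.List.Base using (allFin)
open import Function.Bundles using (_↔_; Inverse)

record Graph : Set where
  field
    p    : ℕ
    q    : ℕ
    ends : Fin q → Fin p × Fin p
open Graph public

Elem : Graph → Set
Elem G = Fin (p G) ⊎ Fin (q G)

-- A bijection {1,…,ℓ} → V ⊔ E, positions encoded 0-based by Fin ℓ
-- (costs are differences of positions, so the shift is irrelevant).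
Bij : Graph → Set
Bij G = Fin (p G + q G) ↔ Elem G

pos : (G : Graph) → Bij G → Elem G → ℕ
pos G x a = toℕ (Inverse.from x a)

IsCSeq : (G : Graph) → Bij G → Set
IsCSeq G x = ∀ (e : Fin (q G)) →
  (pos G x (inj₁ (proj₁ (ends G e))) < pos G x (inj₂ e)) ×
  (pos G x (inj₁ (proj₂ (ends G e))) < pos G x (inj₂ e))

edgeCost : (G : Graph) → Bij G → Fin (q G) → ℕ
edgeCost G x e =
  (pos G x (inj₂ e) ∸ pos G x (inj₁ (proj₁ (ends G e)))) +
  (pos G x (inj₂ e) ∸ pos G x (inj₁ (proj₂ (ends G e))))

cost : (G : Graph) → Bij G → ℕ
cost G x = sum (map (edgeCost G x) (allFin (q G)))

IsMaxCost : Graph → ℕ → Set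
IsMaxCost G m =
  (Σ (Bij G) λ x → IsCSeq G x × (cost G x ≡ m)) ×
  (∀ (x : Bij G) → IsCSeq G x → cost G x ≤ m)

next : ∀ {n} → Fin n → Fin n
next {suc m} i = suc (toℕ i) mod suc m

-- The wheel W_n: hub = vertex 0, cycle vertices 1..n (vertex suc i for i : Fin n).
-- Edges Fin (n + n): the first n are spokes (hub, suc i),
-- the last n are rim edges (suc i, suc (i+1 mod n)).
wheelEnds : ∀ n → Fin (n + n) → Fin (suc n) × Fin (suc n)
wheelEnds n e with splitAt n e
... | inj₁ i = F.zero , F.suc i
... | inj₂ i = F.suc i , F.suc (next i)

Wheel : ℕ → Graph
Wheel n = record { p = suc n ; q = n + n ; ends = wheelEnds n }

-- Summing the cost over all edges gives ν(x) = 2 Σₑ pos e − Σ_v deg v · pos v.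
-- In W_n the hub has degree n ≥ 3 and every rim vertex degree 3, so ν(x) ≤ 2 Σₑ pos e − 3 Σ_v pos v.
-- The n + 1 vertex positions are distinct, hence sum to at least 0 + 1 + ⋯ + n; the 2n edge
-- positions are distinct and at most 3n, hence sum to at most 3n + (3n − 1) + ⋯ + (n + 1).
-- This gives 2ν(x) ≤ 13n² + n, with equality for the order listing all vertices first.
module Submission where

open import Defs
import Algebra.Properties.Semiring.Sum as Sum
open import Data.Fin using (Fin; zero; suc; toℕ; inject₁; fromℕ; punchIn; _↑ˡ_; _↑ʳ_)
open import Data.Fin.Properties
  using (toℕ-injective; toℕ<n; toℕ-fromℕ<; toℕ-inject₁; toℕ-fromℕ; toℕ-↑ˡ; toℕ-↑ʳ;
         splitAt-↑ˡ; splitAt-↑ʳ; punchIn-injective; punchInᵢ≢i; any?; +↔⊎)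
open import Data.List using (map; allFin; tabulate; _∷_; [])
open import Data.List.Properties using (map-tabulate)
import Data.Nat.ListAction as List
open import Data.Nat
  using (ℕ; zero; suc; pred; _+_; _*_; _∸_; _≤_; _<_; z≤n; s≤s; s≤s⁻¹; ≢-nonZero; _≟_)
open import Data.Nat.DivMod using (_/_; _mod_; _%_; m<n⇒m%n≡m; n%n≡0; m*n/n≡m; /-monoˡ-≤)
open import Data.Nat.Properties
open import Data.Nat.Tactic.RingSolver using (solve-∀; solve)
open import Data.Product using (_×_; _,_; proj₁; proj₂)
open import Data.Sum using (inj₁; inj₂)
open import Data.Sum.Properties using (inj₁-injective; inj₂-injective)
open import Data.Vec.Functional using (removeAt; init)
open import Function using (_∘_)
open import Function.Bundles using (Injection)
open import Function.Definitions using (Injective)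
open import Function.Properties.Inverse using (↔-sym; ↔⇒↣)
open import Relation.Binary.PropositionalEquality
open import Relation.Nullary using (yes; no; contradiction)

open import Algebra.Properties.CommutativeSemigroup +-commutativeSemigroup
  using () renaming (interchange to +-interchange)
open Sum +-*-semiring
  using (sum; sum-syntax; sum-cong-≗; sum-remove; sum-init-last; ∑-distrib-+; *-distribˡ-sum)

∑-const : ∀ m c → ∑[ i < m ] c ≡ m * c
∑-const zero    c = refl
∑-const (suc m) c = cong (c +_) (∑-const m c)

∑-const+ : ∀ m c (f : Fin m → ℕ) → ∑[ i < m ] (c + f i) ≡ m * c + sum f
∑-const+ m c f = trans (∑-distrib-+ (λ _ → c) f) (cong (_+ sum f) (∑-const m c))

∑-↑ : ∀ m n (f : Fin (m + n) → ℕ) →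
      sum f ≡ ∑[ i < m ] f (i ↑ˡ n) + ∑[ j < n ] f (m ↑ʳ j)
∑-↑ zero    n f = refl
∑-↑ (suc m) n f = trans (cong (f zero +_) (∑-↑ m n (f ∘ suc))) (sym (+-assoc (f zero) _ _))

listSum-tabulate : ∀ m (f : Fin m → ℕ) → List.sum (tabulate f) ≡ sum f
listSum-tabulate zero    f = refl
listSum-tabulate (suc m) f = cong (f zero +_) (listSum-tabulate m (f ∘ suc))

listSum-allFin : ∀ m (f : Fin m → ℕ) → List.sum (map f (allFin m)) ≡ sum f
listSum-allFin m f = trans (cong List.sum (map-tabulate (λ i → i) f)) (listSum-tabulate m f)

next-inject₁ : ∀ {m} (i : Fin m) → next {suc m} (inject₁ i) ≡ suc i
next-inject₁ {m} i = toℕ-injective (begin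
  toℕ (suc (toℕ (inject₁ i)) mod suc m) ≡⟨ toℕ-fromℕ< _ ⟩
  suc (toℕ (inject₁ i)) % suc m         ≡⟨ cong (λ k → suc k % suc m) (toℕ-inject₁ i) ⟩
  suc (toℕ i) % suc m                   ≡⟨ m<n⇒m%n≡m (s≤s (toℕ<n i)) ⟩
  suc (toℕ i)                           ∎)
  where open ≡-Reasoning

next-fromℕ : ∀ m → next {suc m} (fromℕ m) ≡ zero
next-fromℕ m = toℕ-injective (begin
  toℕ (suc (toℕ (fromℕ m)) mod suc m) ≡⟨ toℕ-fromℕ< _ ⟩
  suc (toℕ (fromℕ m)) % suc m         ≡⟨ cong (λ k → suc k % suc m) (toℕ-fromℕ m) ⟩
  suc m % suc m                       ≡⟨ n%n≡0 (suc m) ⟩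
  0                                   ∎)
  where open ≡-Reasoning

∑-next : ∀ n (f : Fin n → ℕ) → ∑[ i < n ] f (next i) ≡ sum f
∑-next zero    f = refl
∑-next (suc m) f = begin
  sum (f ∘ next)                             ≡⟨ sum-init-last (f ∘ next) ⟩
  sum (init (f ∘ next)) + f (next (fromℕ m)) ≡⟨ cong₂ _+_ (sum-cong-≗ (cong f ∘ next-inject₁))
                                                         (cong f (next-fromℕ m)) ⟩
  sum (f ∘ suc) + f zero                     ≡⟨ +-comm (sum (f ∘ suc)) (f zero) ⟩
  sum f                                      ∎
  where open ≡-Reasoning

triangle : ℕ → ℕ
triangle m = ∑[ i < m ] toℕ i

triangle-suc : ∀ m → triangle (suc m) ≡ m + triangle m
triangle-suc m = trans (∑-const+ m 1 toℕ) (cong (_+ triangle m) (*-identityʳ m))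

2*triangle[n]+n≡n*n : ∀ n → 2 * triangle n + n ≡ n * n
2*triangle[n]+n≡n*n zero    = refl
2*triangle[n]+n≡n*n (suc n) = begin
  2 * triangle (suc n) + suc n     ≡⟨ cong (λ t → 2 * t + suc n) (triangle-suc n) ⟩
  2 * (n + triangle n) + suc n     ≡⟨ regroup n (triangle n) ⟩
  (2 * triangle n + n) + 2 * n + 1 ≡⟨ cong (λ t → t + 2 * n + 1) (2*triangle[n]+n≡n*n n) ⟩
  n * n + 2 * n + 1                ≡⟨ solve (n ∷ []) ⟩
  suc n * suc n                    ∎
  where
  open ≡-Reasoning
  regroup : ∀ n t → 2 * (n + t) + suc n ≡ (2 * t + n) + 2 * n + 1
  regroup = solve-∀

≤-sum : ∀ {m} (f : Fin m → ℕ) (i : Fin m) → f i ≤ sum f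
≤-sum {suc m} f i = subst (f i ≤_) (sym (sum-remove f)) (m≤m+n (f i) _)

-- Induction on a strict upper bound B of the values: if 0 is a value, drop it; the remaining
-- values (or all of them, if 0 is not a value) are positive, so lower them by one.
private
  mutual
    triangle≤∑-bounded : ∀ B {m} (f : Fin m → ℕ) → (∀ i → f i < B) →
                         Injective _≡_ _≡_ f → triangle m ≤ sum f
    triangle≤∑-bounded _       {zero}  f _   _   = z≤n
    triangle≤∑-bounded zero    {suc m} f f<0 _   = contradiction (f<0 zero) n≮0
    triangle≤∑-bounded (suc B) {suc m} f f<B inj with any? (λ i → f i ≟ 0)
    ... | no ∄i→fi≡0 = ≤-trans (m≤n+m (triangle (suc m)) (suc m))
                                (n+triangle≤∑-positive B f (λ i fi≡0 → ∄i→fi≡0 (i , fi≡0)) f<B inj)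
    ... | yes (i , fi≡0) = begin
      triangle (suc m)          ≡⟨ triangle-suc m ⟩
      m + triangle m            ≤⟨ n+triangle≤∑-positive B (removeAt f i) removed≢0 (f<B ∘ punchIn i)
                                     (punchIn-injective i _ _ ∘ inj) ⟩
      sum (removeAt f i)        ≡⟨ cong (_+ sum (removeAt f i)) fi≡0 ⟨
      f i + sum (removeAt f i)  ≡⟨ sum-remove f ⟨
      sum f                     ∎
      where
      open ≤-Reasoning
      removed≢0 : ∀ j → f (punchIn i j) ≢ 0
      removed≢0 j fj≡0 = punchInᵢ≢i i j (inj (trans fj≡0 (sym fi≡0)))

    n+triangle≤∑-positive : ∀ B {m} (f : Fin m → ℕ) → (∀ i → f i ≢ 0) → (∀ i → f i < suc B) →
                            Injective _≡_ _≡_ f → m + triangle m ≤ sum f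
    n+triangle≤∑-positive B {m} f f≢0 f<B inj = begin
      m + triangle m       ≤⟨ +-monoʳ-≤ m (triangle≤∑-bounded B g g<B g-injective) ⟩
      m + sum g            ≡⟨ cong (_+ sum g) (*-identityʳ m) ⟨
      m * 1 + sum g        ≡⟨ ∑-const+ m 1 g ⟨
      ∑[ i < m ] suc (g i) ≡⟨ sum-cong-≗ suc-g ⟩
      sum f                ∎
      where
      open ≤-Reasoning
      g : Fin m → ℕ
      g i = pred (f i)
      suc-g : ∀ i → suc (g i) ≡ f i
      suc-g i = suc-pred (f i) {{≢-nonZero (f≢0 i)}}
      g<B : ∀ i → g i < B
      g<B i = s≤s⁻¹ (subst (_< suc B) (sym (suc-g i)) (f<B i))
      g-injective : Injective _≡_ _≡_ g
      g-injective {i} {j} gi≡gj = inj (trans (sym (suc-g i)) (trans (cong suc gi≡gj) (suc-g j)))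

triangle≤∑ : ∀ {m} (f : Fin m → ℕ) → Injective _≡_ _≡_ f → triangle m ≤ sum f
triangle≤∑ f = triangle≤∑-bounded (suc (sum f)) f (s≤s ∘ ≤-sum f)

∑+triangle≤ : ∀ {m} K (f : Fin m → ℕ) → (∀ i → f i ≤ K) → Injective _≡_ _≡_ f →
              sum f + triangle m ≤ m * K
∑+triangle≤ {m} K f f≤K inj = begin
  sum f + triangle m           ≤⟨ +-monoʳ-≤ (sum f) (triangle≤∑ (λ i → K ∸ f i) complement-injective) ⟩
  sum f + ∑[ i < m ] (K ∸ f i) ≡⟨ ∑-distrib-+ f (λ i → K ∸ f i) ⟨
  ∑[ i < m ] (f i + (K ∸ f i)) ≡⟨ sum-cong-≗ (m+[n∸m]≡n ∘ f≤K) ⟩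
  ∑[ i < m ] K                 ≡⟨ ∑-const m K ⟩
  m * K                        ∎
  where
  open ≤-Reasoning
  complement-injective : Injective _≡_ _≡_ (λ i → K ∸ f i)
  complement-injective {i} {j} eq = inj (∸-cancelˡ-≡ (f≤K i) (f≤K j) eq)

≤-half : ∀ {m n} → 2 * m ≤ n → m ≤ n / 2
≤-half {m} {n} 2m≤n = begin
  m         ≡⟨ m*n/n≡m m 2 ⟨
  m * 2 / 2 ≤⟨ /-monoˡ-≤ 2 (subst (_≤ n) (*-comm 2 m) 2m≤n) ⟩
  n / 2     ∎
  where open ≤-Reasoning

≡-half : ∀ {m n} → 2 * m ≡ n → m ≡ n / 2
≡-half {m} 2m≡n = trans (sym (m*n/n≡m m 2)) (cong (_/ 2) (trans (*-comm m 2) 2m≡n))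

module _ (G : Graph) (x : Bij G) where

  vertexPos : Fin (p G) → ℕ
  vertexPos v = pos G x (inj₁ v)

  edgePos : Fin (q G) → ℕ
  edgePos e = pos G x (inj₂ e)

  endsPos : Fin (q G) → ℕ
  endsPos e = vertexPos (proj₁ (ends G e)) + vertexPos (proj₂ (ends G e))

  pos-injective : Injective _≡_ _≡_ (pos G x)
  pos-injective = Injection.injective (↔⇒↣ (↔-sym x)) ∘ toℕ-injective

  vertexPos-injective : Injective _≡_ _≡_ vertexPos
  vertexPos-injective = inj₁-injective ∘ pos-injective

  edgePos-injective : Injective _≡_ _≡_ edgePos
  edgePos-injective = inj₂-injective ∘ pos-injective

  cost+∑endsPos≡2*∑edgePos : IsCSeq G x → cost G x + sum endsPos ≡ 2 * sum edgePos
  cost+∑endsPos≡2*∑edgePos cs = begin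
    cost G x + sum endsPos                    ≡⟨ cong (_+ sum endsPos) (listSum-allFin (q G) (edgeCost G x)) ⟩
    sum (edgeCost G x) + sum endsPos          ≡⟨ ∑-distrib-+ (edgeCost G x) endsPos ⟨
    ∑[ e < q G ] (edgeCost G x e + endsPos e) ≡⟨ sum-cong-≗ edgeCost+endsPos ⟩
    ∑[ e < q G ] (2 * edgePos e)              ≡⟨ *-distribˡ-sum 2 edgePos ⟨
    2 * sum edgePos                           ∎
    where
    open ≡-Reasoning
    edgeCost+endsPos : ∀ e → edgeCost G x e + endsPos e ≡ 2 * edgePos e
    edgeCost+endsPos e = begin
      (E ∸ u) + (E ∸ w) + (u + w)   ≡⟨ +-interchange (E ∸ u) (E ∸ w) u w ⟩
      ((E ∸ u) + u) + ((E ∸ w) + w) ≡⟨ cong₂ _+_ (m∸n+n≡m (<⇒≤ (proj₁ (cs e))))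
                                                (m∸n+n≡m (<⇒≤ (proj₂ (cs e)))) ⟩
      E + E                         ≡⟨ cong (E +_) (+-identityʳ E) ⟨
      2 * E                         ∎
      where
      E u w : ℕ
      E = edgePos e
      u = vertexPos (proj₁ (ends G e))
      w = vertexPos (proj₂ (ends G e))

wheelEnds-spoke : ∀ n (i : Fin n) → wheelEnds n (i ↑ˡ n) ≡ (zero , suc i)
wheelEnds-spoke n i rewrite splitAt-↑ˡ n i n = refl

wheelEnds-rim : ∀ n (i : Fin n) → wheelEnds n (n ↑ʳ i) ≡ (suc i , suc (next i))
wheelEnds-rim n i rewrite splitAt-↑ʳ n n i = refl

module _ (n : ℕ) (x : Bij (Wheel n)) where

  hubPos : ℕ
  hubPos = vertexPos (Wheel n) x zero

  rimPos : Fin n → ℕ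
  rimPos i = vertexPos (Wheel n) x (suc i)

  ∑endsPos-wheel : sum (endsPos (Wheel n) x) ≡ n * hubPos + 3 * sum rimPos
  ∑endsPos-wheel = begin
    sum (endsPos (Wheel n) x)
      ≡⟨ ∑-↑ n n (endsPos (Wheel n) x) ⟩
    ∑[ i < n ] endsPos (Wheel n) x (i ↑ˡ n) + ∑[ i < n ] endsPos (Wheel n) x (n ↑ʳ i)
      ≡⟨ cong₂ _+_ (sum-cong-≗ (cong endsPos′ ∘ wheelEnds-spoke n))
                   (sum-cong-≗ (cong endsPos′ ∘ wheelEnds-rim n)) ⟩
    ∑[ i < n ] (hubPos + rimPos i) + ∑[ i < n ] (rimPos i + rimPos (next i))
      ≡⟨ cong₂ _+_ (∑-const+ n hubPos rimPos)
                   (trans (∑-distrib-+ rimPos (rimPos ∘ next)) (cong (R +_) (∑-next n rimPos))) ⟩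
    n * hubPos + R + (R + R)
      ≡⟨ regroup (n * hubPos) R ⟩
    n * hubPos + 3 * R
      ∎
    where
    open ≡-Reasoning
    R : ℕ
    R = sum rimPos
    endsPos′ : Fin (suc n) × Fin (suc n) → ℕ
    endsPos′ (u , w) = vertexPos (Wheel n) x u + vertexPos (Wheel n) x w
    regroup : ∀ a r → a + r + (r + r) ≡ a + 3 * r
    regroup = solve-∀

  cost+n*hub+3*∑rim≡2*∑edgePos : IsCSeq (Wheel n) x →
    cost (Wheel n) x + (n * hubPos + 3 * sum rimPos) ≡ 2 * sum (edgePos (Wheel n) x)
  cost+n*hub+3*∑rim≡2*∑edgePos cs =
    trans (cong (cost (Wheel n) x +_) (sym ∑endsPos-wheel)) (cost+∑endsPos≡2*∑edgePos (Wheel n) x cs)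

-- Adding Z = 3 (n + 1)² + 2 (2n)², written via the closed form of triangle, turns the
-- triangle-number bounds into a polynomial comparison.
private
  2*cost≤-arithmetic : ∀ n c h R S → 3 ≤ n →
    c + (n * h + 3 * R) ≡ 2 * S →
    triangle (suc n) ≤ h + R →
    S + triangle (n + n) ≤ (n + n) * (n + (n + n)) →
    2 * c ≤ 13 * n * n + n
  2*cost≤-arithmetic n c h R S 3≤n cost-identity vertices edges =
    +-cancelʳ-≤ Z (2 * c) (13 * n * n + n) (begin
    2 * c + Z
      ≤⟨ +-monoʳ-≤ (2 * c) (+-monoˡ-≤ (2 * (2 * b + (n + n)))
           (*-monoʳ-≤ 3 (+-monoˡ-≤ (suc n) (*-monoʳ-≤ 2 vertices)))) ⟩
    2 * c + (3 * (2 * (h + R) + suc n) + 2 * (2 * b + (n + n)))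
      ≡⟨ regroup₁ n c h R b ⟩
    (2 * 3) * h + (2 * c + 2 * (3 * R) + W)
      ≤⟨ +-monoˡ-≤ (2 * c + 2 * (3 * R) + W) (*-monoˡ-≤ h (*-monoʳ-≤ 2 3≤n)) ⟩
    (2 * n) * h + (2 * c + 2 * (3 * R) + W)
      ≡⟨ regroup₂ n c h R W ⟩
    2 * (c + (n * h + 3 * R)) + W
      ≡⟨ cong (λ t → 2 * t + W) cost-identity ⟩
    2 * (2 * S) + W
      ≡⟨ regroup₃ n S b ⟩
    4 * (S + b) + (3 * suc n + 4 * n)
      ≤⟨ +-monoˡ-≤ (3 * suc n + 4 * n) (*-monoʳ-≤ 4 edges) ⟩
    4 * ((n + n) * (n + (n + n))) + (3 * suc n + 4 * n)
      ≡⟨ solve (n ∷ []) ⟩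
    13 * n * n + n + (3 * (suc n * suc n) + 2 * ((n + n) * (n + n)))
      ≡⟨ cong₂ (λ s t → 13 * n * n + n + (3 * s + 2 * t))
               (2*triangle[n]+n≡n*n (suc n)) (2*triangle[n]+n≡n*n (n + n)) ⟨
    13 * n * n + n + Z
      ∎)
    where
    open ≤-Reasoning
    a b Z W : ℕ
    a = triangle (suc n)
    b = triangle (n + n)
    Z = 3 * (2 * a + suc n) + 2 * (2 * b + (n + n))
    W = 4 * b + (3 * suc n + 4 * n)
    regroup₁ : ∀ n c h R b → 2 * c + (3 * (2 * (h + R) + suc n) + 2 * (2 * b + (n + n))) ≡
                             (2 * 3) * h + (2 * c + 2 * (3 * R) + (4 * b + (3 * suc n + 4 * n)))
    regroup₁ = solve-∀
    regroup₂ : ∀ n c h R W → (2 * n) * h + (2 * c + 2 * (3 * R) + W) ≡ 2 * (c + (n * h + 3 * R)) + W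
    regroup₂ = solve-∀
    regroup₃ : ∀ n S b → 2 * (2 * S) + (4 * b + (3 * suc n + 4 * n)) ≡ 4 * (S + b) + (3 * suc n + 4 * n)
    regroup₃ = solve-∀

2*cost≤13n²+n : ∀ n → 3 ≤ n → (x : Bij (Wheel n)) → IsCSeq (Wheel n) x →
                2 * cost (Wheel n) x ≤ 13 * n * n + n
2*cost≤13n²+n n 3≤n x cs =
  2*cost≤-arithmetic n (cost (Wheel n) x) (hubPos n x) (sum (rimPos n x)) (sum (edgePos (Wheel n) x))
    3≤n
    (cost+n*hub+3*∑rim≡2*∑edgePos n x cs)
    (triangle≤∑ (vertexPos (Wheel n) x) (vertexPos-injective (Wheel n) x))
    (∑+triangle≤ (n + (n + n)) (edgePos (Wheel n) x) (λ _ → s≤s⁻¹ (toℕ<n _)) (edgePos-injective (Wheel n) x))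

x₀ : ∀ n → Bij (Wheel n)
x₀ n = +↔⊎

vertexPos-x₀ : ∀ n v → vertexPos (Wheel n) (x₀ n) v ≡ toℕ v
vertexPos-x₀ n v = toℕ-↑ˡ v (n + n)

edgePos-x₀ : ∀ n e → edgePos (Wheel n) (x₀ n) e ≡ suc n + toℕ e
edgePos-x₀ n e = toℕ-↑ʳ (suc n) e

x₀-isCSeq : ∀ n → IsCSeq (Wheel n) (x₀ n)
x₀-isCSeq n e = vertex<edge _ , vertex<edge _
  where
  vertex<edge : ∀ v → vertexPos (Wheel n) (x₀ n) v < edgePos (Wheel n) (x₀ n) e
  vertex<edge v rewrite vertexPos-x₀ n v | edgePos-x₀ n e = ≤-trans (toℕ<n v) (m≤m+n (suc n) (toℕ e))

private
  2*cost≡-arithmetic : ∀ n c →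
    c + (n * 0 + 3 * (n + triangle n)) ≡ 2 * ((n + n) * suc n + triangle (n + n)) →
    2 * c ≡ 13 * n * n + n
  2*cost≡-arithmetic n c cost-identity = +-cancelʳ-≡ Z (2 * c) (13 * n * n + n) (begin
    2 * c + Z
      ≡⟨ regroup₁ n c u ⟩
    2 * (c + (n * 0 + 3 * (n + u))) + 3 * n
      ≡⟨ cong (λ t → 2 * t + 3 * n) cost-identity ⟩
    2 * (2 * ((n + n) * suc n + v)) + 3 * n
      ≡⟨ regroup₂ n v ⟩
    8 * (n * n) + 7 * n + 2 * (2 * v + (n + n))
      ≡⟨ cong (λ t → 8 * (n * n) + 7 * n + 2 * t) (2*triangle[n]+n≡n*n (n + n)) ⟩
    8 * (n * n) + 7 * n + 2 * ((n + n) * (n + n))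
      ≡⟨ solve (n ∷ []) ⟩
    13 * n * n + n + (3 * (n * n) + 6 * n)
      ≡⟨ cong (λ t → 13 * n * n + n + (3 * t + 6 * n)) (2*triangle[n]+n≡n*n n) ⟨
    13 * n * n + n + Z
      ∎)
    where
    open ≡-Reasoning
    u v Z : ℕ
    u = triangle n
    v = triangle (n + n)
    Z = 3 * (2 * u + n) + 6 * n
    regroup₁ : ∀ n c u → 2 * c + (3 * (2 * u + n) + 6 * n) ≡ 2 * (c + (n * 0 + 3 * (n + u))) + 3 * n
    regroup₁ = solve-∀
    regroup₂ : ∀ n v → 2 * (2 * ((n + n) * suc n + v)) + 3 * n ≡ 8 * (n * n) + 7 * n + 2 * (2 * v + (n + n))
    regroup₂ = solve-∀

2*cost[x₀]≡13n²+n : ∀ n → 2 * cost (Wheel n) (x₀ n) ≡ 13 * n * n + n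
2*cost[x₀]≡13n²+n n = 2*cost≡-arithmetic n (cost (Wheel n) (x₀ n))
  (subst₂ (λ r s → cost (Wheel n) (x₀ n) + (n * 0 + 3 * r) ≡ 2 * s) ∑rimPos ∑edgePos
          (cost+n*hub+3*∑rim≡2*∑edgePos n (x₀ n) (x₀-isCSeq n)))
  where
  ∑rimPos : sum (rimPos n (x₀ n)) ≡ n + triangle n
  ∑rimPos = begin
    sum (rimPos n (x₀ n))  ≡⟨ sum-cong-≗ (vertexPos-x₀ n ∘ suc) ⟩
    ∑[ i < n ] (1 + toℕ i) ≡⟨ ∑-const+ n 1 toℕ ⟩
    n * 1 + triangle n     ≡⟨ cong (_+ triangle n) (*-identityʳ n) ⟩
    n + triangle n         ∎
    where open ≡-Reasoning
  ∑edgePos : sum (edgePos (Wheel n) (x₀ n)) ≡ (n + n) * suc n + triangle (n + n)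
  ∑edgePos = trans (sum-cong-≗ (edgePos-x₀ n)) (∑-const+ (n + n) (suc n) toℕ)

theorem7 : ∀ (n : ℕ) → 4 ≤ n → IsMaxCost (Wheel n) ((13 * n * n + n) / 2)
theorem7 n 4≤n =
    (x₀ n , x₀-isCSeq n , ≡-half (2*cost[x₀]≡13n²+n n))
  , λ x cs → ≤-half (2*cost≤13n²+n n (≤-trans (n≤1+n 3) 4≤n) x cs)
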